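{- Let $\vec a$ be a base sequence and $r,s\in\mathbb R_{\ge0}$. Then both $j_{\vec a}(r+s)$ and $j_{\vec a}(|r-s|)$ are subsets of the union of the three sets $j_{\vec a}(r)\cup j_{\vec a}(s)$, $\ \{n : n+1\in j_{\vec a}(r)\cup j_{\vec a}(s)\}$, and $\{n: a_n\neq a_{n+1}\}\cup\{n : a_{n+1}\neq a_{n+2}\}$.
   Context: $\mathbb N=\{1,2,\dots\}$. A base sequence is $\vec a=(a_n)_{n\in\mathbb N}$ with $a_n\in\mathbb N$, $a_n\ge2$. Every $r\in\mathbb R_{\ge0}$ has a unique representation $r=[r]+\sum_{n=1}^\infty \frac{r_n}{a_1\cdots a_n}$, where $[r]$ is the integer part of $r$, each $r_n$ is an integer with $0\le r_n<a_n$, and $r_n\neq a_n-1$ for infinitely many $n$; $r_n$ is the $n$-th digit of $r$. Define $j_{\vec a}(r)=\{n\in\mathbb N: r_n\neq r_{n+1}\}$. -}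

module Defs where

open import Data.Nat using (ℕ; zero; suc; _+_; _*_; _∸_; _≤_; _<_)
open import Data.Integer as ℤ using (ℤ; +_; ∣_∣)
open import Data.Product using (Σ; ∃; _×_; _,_)
open import Data.Sum using (_⊎_)
open import Relation.Binary.PropositionalEquality using (_≢_)

-- Indices follow the paper: positions n ≥ 1 are meaningful; the value at
-- index 0 of the sequences below is ignored.

IsBase : (ℕ → ℕ) → Set
IsBase a = ∀ n → 1 ≤ n → 2 ≤ a n

-- A nonnegative real r, given by its (unique) a-adic representation:
-- integer part [r] and digits r_n (n ≥ 1).
record Rep : Set where
  constructor rep
  field
    intPart : ℕ
    digit   : ℕ → ℕ
open Rep public

Valid : (ℕ → ℕ) → Rep → Set
Valid a r =
  (∀ n → 1 ≤ n → digit r n < a n) ×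
  (∀ m → Σ ℕ λ n → m ≤ n × 1 ≤ n × digit r n ≢ a n ∸ 1)

-- Scaled truncation: P_N(r) = a_1⋯a_N · ([r] + Σ_{n ≤ N} r_n / (a_1⋯a_n)).
trunc : (ℕ → ℕ) → Rep → ℕ → ℕ
trunc a r zero    = intPart r
trunc a r (suc N) = trunc a r N * a (suc N) + digit r (suc N)

-- Value equality  t = r + s  of the represented reals.  Since
-- a_1⋯a_N · x ∈ [P_N(x), P_N(x)+1] and a_1⋯a_N → ∞, t = r + s holds iff the
-- integers P_N(t) - P_N(r) - P_N(s) are bounded in N.
IsSum : (ℕ → ℕ) → Rep → Rep → Rep → Set
IsSum a t r s = ∃ λ B → ∀ N →
  ∣ (+ trunc a t N) ℤ.- (+ trunc a r N) ℤ.- (+ trunc a s N) ∣ ≤ B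

IsAbsDiff : (ℕ → ℕ) → Rep → Rep → Rep → Set
IsAbsDiff a t r s = IsSum a r t s ⊎ IsSum a s t r

J : Rep → ℕ → Set
J r n = 1 ≤ n × digit r n ≢ digit r (suc n)

Bound : (ℕ → ℕ) → Rep → Rep → ℕ → Set
Bound a r s n =
  (J r n ⊎ J s n) ⊎
  (J r (suc n) ⊎ J s (suc n)) ⊎
  (1 ≤ n × (a n ≢ a (suc n) ⊎ a (suc n) ≢ a (suc (suc n))))

{-# OPTIONS --safe #-}
module Submission where

open import Defs
open import Data.Nat
  using ( ℕ; zero; suc; _+_; _*_; _∸_; _≤_; _<_; _≤′_; ≤′-refl; ≤′-step; z≤n; s≤s
        ; ∣_-_∣; _≟_; _≤?_; >-nonZero )
open import Data.Nat.Properties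
open import Data.Nat.Tactic.RingSolver using (solve-∀)
open import Data.Integer as ℤ using (+_; _⊖_)
import Data.Integer.Properties as ℤ
open import Data.Product using (_×_; ∃-syntax; _,_; proj₁; proj₂)
open import Data.Sum using (inj₁; inj₂)
open import Data.Empty using (⊥-elim)
open import Function using (_∘_)
open import Relation.Nullary using (¬_; Dec; ¬?; _×-dec_; _⊎-dec_)
open import Relation.Nullary.Decidable using (decidable-stable)
open import Relation.Binary.PropositionalEquality
  using (_≡_; _≢_; refl; sym; trans; cong; cong₂; subst; module ≡-Reasoning)

-- Think of t = r + s as column addition in the mixed base a.  The scaled
-- truncations satisfy P_N(t) = P_N(r) + P_N(s) + c_N with a carry c_N ∈ {0, 1}:
-- an excess P_N(t) - P_N(r) - P_N(s) ≥ 2, or a deficit ≥ 1, persists from N to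
-- N + 1 and grows by one at each non-maximal digit of r, resp. t, contradicting
-- boundedness.  Column N + 1 then reads
--   c_N a_{N+1} + t_{N+1} = r_{N+1} + s_{N+1} + c_{N+1}.
-- If a, r and s are constant on n, n+1, n+2, the three columns there share
-- their data; since the carry out of such a column is monotone in the carry
-- in, c_{n-1} = c_n = c_{n+1}, and hence t_n = t_{n+1}.  For |r - s| the same
-- applies to r = t + s (or s = t + r), with t now a summand.

∣m⊖n∣≡∣m-n∣ : ∀ m n → ℤ.∣ m ⊖ n ∣ ≡ ∣ m - n ∣
∣m⊖n∣≡∣m-n∣ m n with ≤-total m n
... | inj₁ m≤n = trans (ℤ.∣⊖∣-≤ m≤n) (sym (m≤n⇒∣m-n∣≡n∸m m≤n))
... | inj₂ n≤m = trans (ℤ.∣m⊖n∣≡∣n⊖m∣ m n) (trans (ℤ.∣⊖∣-≤ n≤m) (sym (m≤n⇒∣n-m∣≡n∸m n≤m)))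

∣x-y-z∣≡∣x-[y+z]∣ : ∀ x y z → ℤ.∣ + x ℤ.- + y ℤ.- + z ∣ ≡ ∣ x - (y + z) ∣
∣x-y-z∣≡∣x-[y+z]∣ x y z = trans (cong ℤ.∣_∣ x-y-z≡x⊖[y+z]) (∣m⊖n∣≡∣m-n∣ x (y + z))
  where
  open ≡-Reasoning
  x-y-z≡x⊖[y+z] : + x ℤ.- + y ℤ.- + z ≡ x ⊖ (y + z)
  x-y-z≡x⊖[y+z] = begin
    + x ℤ.- + y ℤ.- + z           ≡⟨ ℤ.+-assoc (+ x) (ℤ.- + y) (ℤ.- + z) ⟩
    + x ℤ.+ (ℤ.- + y ℤ.- + z)     ≡⟨ cong (ℤ._+_ (+ x)) (sym (ℤ.neg-distrib-+ (+ y) (+ z))) ⟩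
    + x ℤ.- (+ y ℤ.+ + z)         ≡⟨ cong (λ w → + x ℤ.- w) (sym (ℤ.pos-+ y z)) ⟩
    + x ℤ.- + (y + z)             ≡⟨ ℤ.m-n≡m⊖n x (y + z) ⟩
    x ⊖ (y + z)                   ∎

<∧≢∸1⇒suc< : ∀ {m n} → m < n → m ≢ n ∸ 1 → suc m < n
<∧≢∸1⇒suc< m<n m≢n∸1 = ≤∧≢⇒< m<n (m≢n∸1 ∘ cong (_∸ 1))

excess-step : ∀ {A X Y Z x y z E} d → 0 < A →
  2 + E + (X + Y) ≤ Z → d + (suc x + suc y) ≤ A + A →
  2 + (d + E) + ((X * A + x) + (Y * A + y)) ≤ Z * A + z
excess-step {A} {X} {Y} {Z} {x} {y} {z} {E} d 0<A excess digits = begin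
  2 + (d + E) + ((X * A + x) + (Y * A + y)) ≡⟨ regroup d E X Y A x y ⟩
  (d + (suc x + suc y)) + E + (X + Y) * A   ≤⟨ +-monoˡ-≤ ((X + Y) * A) (+-mono-≤ digits E≤E*A) ⟩
  (A + A) + E * A + (X + Y) * A             ≡⟨ factor E X Y A ⟩
  (2 + E + (X + Y)) * A                     ≤⟨ *-monoˡ-≤ A excess ⟩
  Z * A                                     ≤⟨ m≤m+n (Z * A) z ⟩
  Z * A + z                                 ∎
  where
  open ≤-Reasoning
  regroup : ∀ d E X Y A x y →
    2 + (d + E) + ((X * A + x) + (Y * A + y)) ≡ (d + (suc x + suc y)) + E + (X + Y) * A
  regroup = solve-∀
  factor : ∀ E X Y A → (A + A) + E * A + (X + Y) * A ≡ (2 + E + (X + Y)) * A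
  factor = solve-∀
  E≤E*A : E ≤ E * A
  E≤E*A = m≤m*n E A ⦃ >-nonZero 0<A ⦄

deficit-step : ∀ {A X Y Z x y z E} d → 0 < A →
  1 + E + Z ≤ X + Y → d + suc z ≤ A →
  1 + (d + E) + (Z * A + z) ≤ (X * A + x) + (Y * A + y)
deficit-step {A} {X} {Y} {Z} {x} {y} {z} {E} d 0<A deficit digit = begin
  1 + (d + E) + (Z * A + z)  ≡⟨ regroup d E Z A z ⟩
  (d + suc z) + E + Z * A    ≤⟨ +-monoˡ-≤ (Z * A) (+-mono-≤ digit E≤E*A) ⟩
  A + E * A + Z * A          ≡⟨ factor E Z A ⟩
  (1 + E + Z) * A            ≤⟨ *-monoˡ-≤ A deficit ⟩
  (X + Y) * A                ≡⟨ *-distribʳ-+ A X Y ⟩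
  X * A + Y * A              ≤⟨ +-mono-≤ (m≤m+n (X * A) x) (m≤m+n (Y * A) y) ⟩
  (X * A + x) + (Y * A + y)  ∎
  where
  open ≤-Reasoning
  regroup : ∀ d E Z A z → 1 + (d + E) + (Z * A + z) ≡ (d + suc z) + E + Z * A
  regroup = solve-∀
  factor : ∀ E Z A → A + E * A + Z * A ≡ (1 + E + Z) * A
  factor = solve-∀
  E≤E*A : E ≤ E * A
  E≤E*A = m≤m*n E A ⦃ >-nonZero 0<A ⦄

column-from-truncations : ∀ {A X Y Z x y z c c′} →
  Z ≡ X + Y + c → Z * A + z ≡ (X * A + x) + (Y * A + y) + c′ →
  c * A + z ≡ x + y + c′
column-from-truncations {A} {X} {Y} {Z} {x} {y} {z} {c} {c′} Z≡ Z′≡ =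
  +-cancelˡ-≡ ((X + Y) * A) _ _ (begin
    (X + Y) * A + (c * A + z)            ≡⟨ collect X Y c A z ⟩
    (X + Y + c) * A + z                  ≡⟨ cong (λ w → w * A + z) Z≡ ⟨
    Z * A + z                            ≡⟨ Z′≡ ⟩
    (X * A + x) + (Y * A + y) + c′       ≡⟨ separate X Y A x y c′ ⟩
    (X + Y) * A + (x + y + c′)           ∎)
  where
  open ≡-Reasoning
  collect : ∀ X Y c A z → (X + Y) * A + (c * A + z) ≡ (X + Y + c) * A + z
  collect = solve-∀
  separate : ∀ X Y A x y c′ → (X * A + x) + (Y * A + y) + c′ ≡ (X + Y) * A + (x + y + c′)
  separate = solve-∀

module _ {P : ℕ → ℕ → Set} {Q : ℕ → Set}
         (persists : ∀ k N → P k N → P k (suc N))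
         (grows : ∀ k N → P k N → Q (suc N) → P (suc k) (suc N)) where

  private
    persists-until : ∀ {k M N} → P k M → M ≤′ N → P k N
    persists-until p ≤′-refl        = p
    persists-until p (≤′-step M≤′N) = persists _ _ (persists-until p M≤′N)

  unbounded : (∀ m → ∃[ n ] m ≤ n × Q n) → ∀ N → P 0 N → ∀ k → ∃[ M ] P k M
  unbounded often N p zero = N , p
  unbounded often N p (suc k) with unbounded often N p k
  ... | M , pM with often (suc M)
  ... | suc n , s≤s M≤n , q = suc n , grows k n (persists-until pM (≤⇒≤′ M≤n)) q

NonMaximal : (ℕ → ℕ) → Rep → ℕ → Set
NonMaximal a x n = 1 ≤ n × digit x n ≢ a n ∸ 1

digit<base : ∀ {a} x → Valid a x → ∀ N → digit x (suc N) < a (suc N)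
digit<base _ valid N = proj₁ valid (suc N) (s≤s z≤n)

module Carries (a : ℕ → ℕ) {t r s : Rep}
  (valid-t : Valid a t) (valid-r : Valid a r) (valid-s : Valid a s)
  (t≈r+s : IsSum a t r s) where

  private
    T R S : ℕ → ℕ
    T = trunc a t
    R = trunc a r
    S = trunc a s

    base>0 : ∀ N → 0 < a (suc N)
    base>0 N = ≤-trans (s≤s z≤n) (digit<base t valid-t N)

    Excess Deficit : ℕ → ℕ → Set
    Excess  k N = 2 + k + (R N + S N) ≤ T N
    Deficit k N = 1 + k + T N ≤ R N + S N

    excess-step′ : ∀ k N d →
      Excess k N → d + (suc (digit r (suc N)) + suc (digit s (suc N))) ≤ a (suc N) + a (suc N) →
      Excess (d + k) (suc N)
    excess-step′ k N d = excess-step {X = R N} {Y = S N} {Z = T N} {E = k} d (base>0 N)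

    deficit-step′ : ∀ k N d →
      Deficit k N → d + suc (digit t (suc N)) ≤ a (suc N) → Deficit (d + k) (suc N)
    deficit-step′ k N d =
      deficit-step {X = R N} {Y = S N} {Z = T N} {x = digit r (suc N)} {y = digit s (suc N)} {E = k}
        d (base>0 N)

    excess-unbounded : ∀ N → Excess 0 N → ∀ k → ∃[ M ] Excess k M
    excess-unbounded = unbounded {P = Excess} persists grows (proj₂ valid-r)
      where
      persists : ∀ k N → Excess k N → Excess k (suc N)
      persists k N e = excess-step′ k N 0 e
        (+-mono-≤ (digit<base r valid-r N) (digit<base s valid-s N))
      grows : ∀ k N → Excess k N → NonMaximal a r (suc N) → Excess (suc k) (suc N)
      grows k N e (_ , r≢max) = excess-step′ k N 1 e
        (+-mono-≤ (<∧≢∸1⇒suc< (digit<base r valid-r N) r≢max) (digit<base s valid-s N))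

    deficit-unbounded : ∀ N → Deficit 0 N → ∀ k → ∃[ M ] Deficit k M
    deficit-unbounded = unbounded {P = Deficit} persists grows (proj₂ valid-t)
      where
      persists : ∀ k N → Deficit k N → Deficit k (suc N)
      persists k N e = deficit-step′ k N 0 e (digit<base t valid-t N)
      grows : ∀ k N → Deficit k N → NonMaximal a t (suc N) → Deficit (suc k) (suc N)
      grows k N e (_ , t≢max) = deficit-step′ k N 1 e
        (<∧≢∸1⇒suc< (digit<base t valid-t N) t≢max)

    B : ℕ
    B = proj₁ t≈r+s

    gap≤B : ∀ N → ∣ T N - (R N + S N) ∣ ≤ B
    gap≤B N = subst (_≤ B) (∣x-y-z∣≡∣x-[y+z]∣ (T N) (R N) (S N)) (proj₂ t≈r+s N)

    excess<gap : ∀ k N → Excess k N → k < ∣ T N - (R N + S N) ∣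
    excess<gap k N e =
      <⇒≤ (≤-trans (m+n≤o⇒m≤o∸n (2 + k) e) (m∸n≤∣m-n∣ (T N) (R N + S N)))

    deficit<gap : ∀ k N → Deficit k N → k < ∣ T N - (R N + S N) ∣
    deficit<gap k N d = begin-strict
      k                         <⟨ m+n≤o⇒m≤o∸n (1 + k) d ⟩
      (R N + S N) ∸ T N         ≤⟨ m∸n≤∣m-n∣ (R N + S N) (T N) ⟩
      ∣ (R N + S N) - T N ∣     ≡⟨ ∣-∣-comm (R N + S N) (T N) ⟩
      ∣ T N - (R N + S N) ∣     ∎
      where open ≤-Reasoning

    R+S≤T : ∀ N → R N + S N ≤ T N
    R+S≤T N = ≮⇒≥ λ deficit →
      let M , d = deficit-unbounded N deficit B in <⇒≱ (deficit<gap B M d) (gap≤B M)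

    T≤1+R+S : ∀ N → T N ≤ 1 + (R N + S N)
    T≤1+R+S N = ≮⇒≥ λ excess →
      let M , e = excess-unbounded N excess B in <⇒≱ (excess<gap B M e) (gap≤B M)

  carry : ℕ → ℕ
  carry N = T N ∸ (R N + S N)

  carry≤1 : ∀ N → carry N ≤ 1
  carry≤1 N =
    ≤-trans (∸-monoˡ-≤ (R N + S N) (T≤1+R+S N)) (≤-reflexive (m+n∸n≡m 1 (R N + S N)))

  column-equation : ∀ N →
    carry N * a (suc N) + digit t (suc N) ≡ digit r (suc N) + digit s (suc N) + carry (suc N)
  column-equation N =
    column-from-truncations {X = R N} {Y = S N} {x = digit r (suc N)} {y = digit s (suc N)}
      (T≡R+S+carry N) (T≡R+S+carry (suc N))
    where
    T≡R+S+carry : ∀ N → T N ≡ R N + S N + carry N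
    T≡R+S+carry N = sym (m+[n∸m]≡n (R+S≤T N))

record Flat {A : Set} (f : ℕ → A) (n : ℕ) : Set where
  constructor flat
  field
    flat₁ : f n ≡ f (suc n)
    flat₂ : f (suc n) ≡ f (suc (suc n))

flat-zipWith : ∀ {A B C : Set} (g : A → B → C) {f : ℕ → A} {h : ℕ → B} {n} →
  Flat f n → Flat h n → Flat (λ k → g (f k) (h k)) n
flat-zipWith g (flat f₁ f₂) (flat h₁ h₂) = flat (cong₂ g f₁ h₁) (cong₂ g f₂ h₂)

-- Column d c t c′: a column with data d and digit t, carrying c out to the more
-- significant side and receiving carry c′ from the less significant one.
module Columns {D : Set} (Column : D → ℕ → ℕ → ℕ → Set)
  (carry-out-monotone : ∀ {d t t′ c c′} → Column d 1 t c → Column d 0 t′ c′ → c′ < c)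
  (digit-unique : ∀ {d c c′ t t′} → Column d c t c′ → Column d c t′ c′ → t ≡ t′) where

  carry-out≡carry-in : ∀ {d c₀ c₁ c₂ t₁ t₂} → c₀ ≤ 1 → c₁ ≤ 1 → c₂ ≤ 1 →
    Column d c₀ t₁ c₁ → Column d c₁ t₂ c₂ → c₀ ≡ c₁
  carry-out≡carry-in {c₀ = 0} {c₁ = 0} _ _ _ _ _ = refl
  carry-out≡carry-in {c₀ = 1} {c₁ = 1} _ _ _ _ _ = refl
  carry-out≡carry-in {c₀ = 0} {c₁ = 1} _ _ c₂≤1 col₁ col₂ =
    ⊥-elim (<⇒≱ (carry-out-monotone col₂ col₁) c₂≤1)
  carry-out≡carry-in {c₀ = 1} {c₁ = 0} _ _ _ col₁ col₂ =
    ⊥-elim (n≮0 (carry-out-monotone col₁ col₂))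
  carry-out≡carry-in {c₀ = suc (suc _)} (s≤s ()) _ _ _ _
  carry-out≡carry-in {c₁ = suc (suc _)} _ (s≤s ()) _ _ _

  steady-digit : ∀ {d₁ d₂ d₃ c₀ c₁ c₂ c₃ t₁ t₂ t₃} → d₁ ≡ d₂ → d₂ ≡ d₃ →
    c₀ ≤ 1 → c₁ ≤ 1 → c₂ ≤ 1 → c₃ ≤ 1 →
    Column d₁ c₀ t₁ c₁ → Column d₂ c₁ t₂ c₂ → Column d₃ c₂ t₃ c₃ → t₁ ≡ t₂
  steady-digit refl refl c₀≤1 c₁≤1 c₂≤1 c₃≤1 col₁ col₂ col₃
    with carry-out≡carry-in c₀≤1 c₁≤1 c₂≤1 col₁ col₂
       | carry-out≡carry-in c₁≤1 c₂≤1 c₃≤1 col₂ col₃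
  ... | refl | refl = digit-unique col₁ col₂

  steady-run : (d : ℕ → D) (t : ℕ → ℕ) {c : ℕ → ℕ} → (∀ N → c N ≤ 1) →
    (∀ N → Column (d (suc N)) (c N) (t (suc N)) (c (suc N))) →
    ∀ m → Flat d (suc m) → t (suc m) ≡ t (suc (suc m))
  steady-run d t c≤1 column m (flat d₁≡d₂ d₂≡d₃) =
    steady-digit d₁≡d₂ d₂≡d₃ (c≤1 m) (c≤1 (1 + m)) (c≤1 (2 + m)) (c≤1 (3 + m))
      (column m) (column (1 + m)) (column (2 + m))

data SumColumn : ℕ × ℕ → ℕ → ℕ → ℕ → Set where
  sum-column : ∀ {A x c t c′} → t < A → c * A + t ≡ x + c′ → SumColumn (A , x) c t c′

sum-carry-out-monotone : ∀ {d t t′ c c′} → SumColumn d 1 t c → SumColumn d 0 t′ c′ → c′ < c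
sum-carry-out-monotone {A , x} {t} {t′} {c} {c′} (sum-column _ eq) (sum-column t′<A eq′) =
  ≰⇒> λ c≤c′ → <-irrefl refl (begin-strict
    A          ≡⟨ *-identityˡ A ⟨
    1 * A      ≤⟨ m≤m+n (1 * A) t ⟩
    1 * A + t  ≡⟨ eq ⟩
    x + c      ≤⟨ +-monoʳ-≤ x c≤c′ ⟩
    x + c′     ≡⟨ eq′ ⟨
    t′         <⟨ t′<A ⟩
    A          ∎)
  where open ≤-Reasoning

sum-digit-unique : ∀ {d c c′ t t′} → SumColumn d c t c′ → SumColumn d c t′ c′ → t ≡ t′
sum-digit-unique {A , _} {c} {_} {t} {t′} (sum-column _ eq) (sum-column _ eq′) =
  +-cancelˡ-≡ (c * A) t t′ (trans eq (sym eq′))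

data DiffColumn : ℕ × ℕ × ℕ → ℕ → ℕ → ℕ → Set where
  diff-column : ∀ {A y z c t c′} → t < A → c * A + y ≡ t + z + c′ → DiffColumn (A , y , z) c t c′

diff-carry-out-monotone : ∀ {d t t′ c c′} → DiffColumn d 1 t c → DiffColumn d 0 t′ c′ → c′ < c
diff-carry-out-monotone {A , y , z} {t} {t′} {c} {c′} (diff-column t<A eq) (diff-column _ eq′) =
  ≰⇒> λ c≤c′ → <-irrefl refl (begin-strict
    1 * A + y          ≡⟨ eq ⟩
    t + z + c          <⟨ +-monoˡ-< c (+-monoˡ-< z t<A) ⟩
    A + z + c          ≤⟨ +-monoʳ-≤ (A + z) c≤c′ ⟩
    A + z + c′         ≡⟨ +-assoc A z c′ ⟩
    A + (z + c′)       ≤⟨ +-monoʳ-≤ A (+-monoˡ-≤ c′ (m≤n+m z t′)) ⟩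
    A + (t′ + z + c′)  ≡⟨ cong (_+_ A) eq′ ⟨
    A + y              ≡⟨ cong (_+ y) (*-identityˡ A) ⟨
    1 * A + y          ∎)
  where open ≤-Reasoning

diff-digit-unique : ∀ {d c c′ t t′} → DiffColumn d c t c′ → DiffColumn d c t′ c′ → t ≡ t′
diff-digit-unique {_ , _ , z} {_} {c′} {t} {t′} (diff-column _ eq) (diff-column _ eq′) =
  +-cancelʳ-≡ z t t′ (+-cancelʳ-≡ c′ (t + z) (t′ + z) (trans (sym eq) eq′))

J? : ∀ x n → Dec (J x n)
J? x n = (1 ≤? n) ×-dec ¬? (digit x n ≟ digit x (suc n))

Bound? : ∀ a r s n → Dec (Bound a r s n)
Bound? a r s n =
  (J? r n ⊎-dec J? s n) ⊎-dec (J? r (suc n) ⊎-dec J? s (suc n)) ⊎-dec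
  ((1 ≤? n) ×-dec (¬? (a n ≟ a (suc n)) ⊎-dec ¬? (a (suc n) ≟ a (suc (suc n)))))

flat-outside-bound : ∀ a r s {m} → ¬ Bound a r s (suc m) →
  Flat a (suc m) × Flat (digit r) (suc m) × Flat (digit s) (suc m)
flat-outside-bound a r s ¬bound =
  flat (≡-stable λ ne → ¬bound (inj₂ (inj₂ (s≤s z≤n , inj₁ ne))))
       (≡-stable λ ne → ¬bound (inj₂ (inj₂ (s≤s z≤n , inj₂ ne)))) ,
  flat (≡-stable λ ne → ¬bound (inj₁ (inj₁ (s≤s z≤n , ne))))
       (≡-stable λ ne → ¬bound (inj₂ (inj₁ (inj₁ (s≤s z≤n , ne))))) ,
  flat (≡-stable λ ne → ¬bound (inj₁ (inj₂ (s≤s z≤n , ne))))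
       (≡-stable λ ne → ¬bound (inj₂ (inj₁ (inj₂ (s≤s z≤n , ne)))))
  where
  ≡-stable : ∀ {x y} → ¬ x ≢ y → x ≡ y
  ≡-stable = decidable-stable (_ ≟ _)

NoJumpOnFlats : (ℕ → ℕ) → Rep → Rep → Rep → Set
NoJumpOnFlats a r s t = ∀ m →
  Flat a (suc m) → Flat (digit r) (suc m) → Flat (digit s) (suc m) →
  digit t (suc m) ≡ digit t (suc (suc m))

jumps-bounded : ∀ {a} r s t → NoJumpOnFlats a r s t → ∀ n → J t n → Bound a r s n
jumps-bounded {a} r s t no-jump (suc m) (_ , t-jumps) =
  decidable-stable (Bound? a r s (suc m)) λ ¬bound →
    let flat-a , flat-r , flat-s = flat-outside-bound a r s ¬bound
    in  t-jumps (no-jump m flat-a flat-r flat-s)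

sum-no-jump : ∀ {a} t r s → Valid a t → Valid a r → Valid a s →
  IsSum a t r s → NoJumpOnFlats a r s t
sum-no-jump {a} t r s valid-t valid-r valid-s t≈r+s m flat-a flat-r flat-s =
  steady-run (λ k → a k , digit r k + digit s k) (digit t) carry≤1
    (λ N → sum-column (digit<base t valid-t N) (column-equation N))
    m (flat-zipWith _,_ flat-a (flat-zipWith _+_ flat-r flat-s))
  where
  open Carries a valid-t valid-r valid-s t≈r+s
  open Columns SumColumn sum-carry-out-monotone sum-digit-unique

summand-no-jump : ∀ {a} u t s → Valid a u → Valid a t → Valid a s →
  IsSum a u t s → NoJumpOnFlats a u s t
summand-no-jump {a} u t s valid-u valid-t valid-s u≈t+s m flat-a flat-u flat-s =
  steady-run (λ k → a k , digit u k , digit s k) (digit t) carry≤1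
    (λ N → diff-column (digit<base t valid-t N) (column-equation N))
    m (flat-zipWith _,_ flat-a (flat-zipWith _,_ flat-u flat-s))
  where
  open Carries a valid-u valid-t valid-s u≈t+s
  open Columns DiffColumn diff-carry-out-monotone diff-digit-unique

lemma2p4 : (a : ℕ → ℕ) → IsBase a → (r s : Rep) → Valid a r → Valid a s →
    ((t : Rep) → Valid a t → IsSum a t r s → ∀ n → J t n → Bound a r s n) ×
    ((t : Rep) → Valid a t → IsAbsDiff a t r s → ∀ n → J t n → Bound a r s n)
lemma2p4 a _ r s valid-r valid-s =
  (λ t valid-t t≈r+s → jumps-bounded r s t (sum-no-jump t r s valid-t valid-r valid-s t≈r+s)) ,
  λ { t valid-t (inj₁ r≈t+s) →
        jumps-bounded r s t (summand-no-jump r t s valid-r valid-t valid-s r≈t+s)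
    ; t valid-t (inj₂ s≈t+r) → jumps-bounded r s t λ m flat-a flat-r flat-s →
        summand-no-jump s t r valid-s valid-t valid-r s≈t+r m flat-a flat-s flat-r }
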